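{- Let $k$ be a positive integer. (i) If $k\equiv 3 \pmod 5$, then $va_3^{\equiv}(K_{4k+2,4k+2,4k+2})\leq \frac{12k+9}{5}$. (ii) If $k\equiv 4 \pmod 5$, then $va_3^{\equiv}(K_{4k+2,4k+2,4k+2})\leq \frac{12k+12}{5}$. (iii) If $k\equiv 0 \pmod 5$, then $va_3^{\equiv}(K_{4k+2,4k+2,4k+2})\leq \frac{12k+15}{5}$. (iv) If $k\equiv 1 \pmod 5$, then $va_3^{\equiv}(K_{4k+2,4k+2,4k+2})\leq \frac{12k+18}{5}$.
   Context: All graphs are finite and simple. A $t$-coloring of a graph $G$ is a map $f:V(G)\to\{1,\dots,t\}$, with color classes $V_i=\{v: f(v)=i\}$. It is equitable if $\big||V_i|-|V_j|\big|\le 1$ for all $i,j$. A $(t,k)$-tree-coloring of $G$ is a $t$-coloring such that every connected component of each induced subgraph $G[V_i]$ is a tree of maximum degree at most $k$; an equitable $(t,k)$-tree-coloring is a $(t,k)$-tree-coloring that is equitable. The strong equitable vertex $k$-arboricity $va_k^{\equiv}(G)$ is the smallest integer $t$ such that $G$ has an equitable $(t',k)$-tree-coloring for every integer $t'\ge t$. $K_{n,n,n}$ denotes the complete tripartite graph whose three partite sets each have exactly $n$ vertices. -}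

module Defs where

open import Data.Nat using (ℕ; _≤_; _*_)
open import Data.Fin using (Fin; _≟_; quotient)
open import Data.Fin.Properties using (all?)
open import Data.List using (List; []; _∷_; _++_; [_]; length; filter)
open import Data.List.Relation.Unary.All using (All)
open import Data.List.Relation.Unary.Linked using (Linked)
open import Data.List.Relation.Unary.Unique.Propositional using (Unique)
open import Data.Product using (_×_; Σ; ∃)
open import Relation.Binary.PropositionalEquality using (_≡_; _≢_; refl) renaming (sym to ≡-sym)
open import Relation.Nullary using (¬_)
open import Data.List using (allFin)

record Graph (N : ℕ) : Set₁ where
  field
    Adj    : Fin N → Fin N → Set
    sym    : ∀ {u v} → Adj u v → Adj v u
    irrefl : ∀ {v} → ¬ Adj v v
open Graph public

Knnn : (n : ℕ) → Graph (3 * n)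
Knnn n = record
  { Adj    = λ u v → quotient {3} n u ≢ quotient {3} n v
  ; sym    = λ p q → p (≡-sym q)
  ; irrefl = λ p → p refl
  }

module _ {N : ℕ} (G : Graph N) where

  record InducedCycle (P : Fin N → Set) : Set where
    field
      first  : Fin N
      rest   : List (Fin N)
      long   : 2 ≤ length rest
      uniq   : Unique (first ∷ rest)
      inP    : All P (first ∷ rest)
      closed : Linked (Adj G) ((first ∷ rest) ++ [ first ])

  MaxDegInducedLe : (P : Fin N → Set) → ℕ → Set
  MaxDegInducedLe P k =
    ∀ v → P v → (ns : List (Fin N)) → Unique ns →
      All (λ u → P u × Adj G v u) ns → length ns ≤ k

  ColorClass : {t : ℕ} → (Fin N → Fin t) → Fin t → Fin N → Set
  ColorClass f i v = f v ≡ i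

  classSize : {t : ℕ} → (Fin N → Fin t) → Fin t → ℕ
  classSize f i = length (filter (λ v → f v ≟ i) (allFin N))

  -- (t,k)-tree-colouring: every component of each G[V_i] is a tree of max
  -- degree ≤ k, i.e. each G[V_i] is acyclic (a forest) with max degree ≤ k.
  IsTreeColoring : (t k : ℕ) → (Fin N → Fin t) → Set
  IsTreeColoring t k f =
    ∀ (i : Fin t) → ¬ InducedCycle (ColorClass f i) × MaxDegInducedLe (ColorClass f i) k

  IsEquitable : (t : ℕ) → (Fin N → Fin t) → Set
  IsEquitable t f = ∀ (i j : Fin t) →
    classSize f i ≤ Data.Nat.suc (classSize f j)

  HasEqTreeColoring : (t k : ℕ) → Set
  HasEqTreeColoring t k =
    ∃ λ (f : Fin N → Fin t) → IsTreeColoring t k f × IsEquitable t f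

  -- va_k^≡(G) is the least t such that G has an equitable (t',k)-tree-colouring
  -- for every integer t' ≥ t.  Hence  va_k^≡(G) ≤ p/q  holds iff every integer
  -- t' with t' ≥ p/q (i.e. p ≤ q * t') admits such a colouring.
  StrongEqVArbLe : (k p q : ℕ) → Set
  StrongEqVArbLe k p q = ∀ (t : ℕ) → p ≤ q * t → HasEqTreeColoring t k

-- Number the vertices of K_{n,n,n} so that part p consists of pn, …, pn + n − 1, and colour by
-- consecutive blocks whose sizes are q or q + 1: such a colouring is equitable. A block inside one
-- part is independent, and a block of at most four vertices with exactly one vertex across a part
-- boundary induces a star with at most three leaves; so it suffices to arrange the block sizes so
-- that every block is of one of these two kinds. For n = 4k + 2 and t colours:
--   t ≤ 3k: each part is tiled on its own by blocks of 4 and 5, possible whenever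
--           3 * ⌈n / 5⌉ ≤ t, and the four bounds of the theorem are exactly 3 * ⌈n / 5⌉;
--   t = 3k + 1: a five in part 0, a run of fours crossing both boundaries, then a five in part 2;
--   3k + 2 ≤ t ≤ n: a three, a run of fours from the odd position 3, then threes — n is even, so
--           every boundary splits a four as 1 + 3 or 3 + 1;
--   t > n: blocks of at most three vertices, which are always good.

module Submission where

open import Defs
open import Data.Nat using (ℕ; _≤_; _*_; _+_; _%_)
open import Relation.Binary.PropositionalEquality using (_≡_)
open import Data.Product using (_×_)

open import Data.Nat using (zero; suc; _∸_; _<_; z≤n; s≤s; z<s; _<?_; _≟_)
open import Data.Nat.Properties
open import Data.Nat.ListAction using (sum)
open import Data.Nat.Divisibility using (_∣_; _∤_; divides; ∣-trans; ∣m+n∣m⇒∣n; _∣?_)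
open import Data.Nat.DivMod using (_/_; m≡m%n+[m/n]*n; m%n<n; m/n*n≤m)
import Data.Fin as Fin
open import Data.Fin using (Fin; toℕ; fromℕ<; quotient; remainder)
open import Data.Fin.Properties using (toℕ-injective; toℕ<n; toℕ-fromℕ<; toℕ-combine; combine-remQuot)
open import Data.List using (List; []; _∷_; _++_; [_]; length; filter; tabulate; take; replicate)
open import Data.List.Properties using (filter-all; filter-accept; filter-reject; length-++; length-replicate)
open import Data.Nat.ListAction.Properties using (sum-++)
open import Data.Nat.Tactic.RingSolver using (solve-∀)
open import Data.List.Relation.Unary.All as All using (All; []; _∷_)
import Data.List.Relation.Unary.All.Properties as All
open import Data.List.Relation.Unary.AllPairs using ([]; _∷_)
open import Data.List.Relation.Unary.Linked using (Linked; _∷_)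
open import Data.List.Relation.Unary.Unique.Propositional using (Unique)
import Data.List.Relation.Unary.Unique.Propositional.Properties as Unique
open import Data.Product using (∃; _,_; proj₁; proj₂)
open import Data.Sum using (_⊎_; inj₁; inj₂; [_,_]′)
open import Data.Bool using (Bool; true; false)
open import Data.Empty using (⊥)
open import Function using (_∘_; id; _⇔_; mk⇔; Equivalence)
open import Relation.Nullary using (¬_; does; yes; no; ¬?; contradiction)
open import Relation.Nullary.Decidable using (does-⇔; from-no)
open import Relation.Unary using (Decidable)
open import Relation.Binary.PropositionalEquality using (refl; trans; cong; cong₂; subst; subst₂; _≢_; module ≡-Reasoning) renaming (sym to ≡-sym)

m+o≡n⇒m≤n : ∀ {m n} o → m + o ≡ n → m ≤ n
m+o≡n⇒m≤n {m} o m+o≡n = subst (m ≤_) m+o≡n (m≤m+n m o)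

count : (ℕ → Bool) → ℕ → ℕ
count R zero    = 0
count R (suc w) with R 0
... | true  = suc (count (R ∘ suc) w)
... | false = count (R ∘ suc) w

count-+ : ∀ R a b → count R (a + b) ≡ count R a + count (R ∘ (a +_)) b
count-+ R zero    b = refl
count-+ R (suc a) b with R 0
... | true  = cong suc (count-+ (R ∘ suc) a b)
... | false = count-+ (R ∘ suc) a b

count-cong : ∀ w {R R′} → (∀ {x} → x < w → R x ≡ R′ x) → count R w ≡ count R′ w
count-cong zero    eq = refl
count-cong (suc w) {R} {R′} eq with R 0 | R′ 0 | eq z<s
... | true  | true  | _ = cong suc (count-cong w (eq ∘ s≤s))
... | false | false | _ = count-cong w (eq ∘ s≤s)

count-true : ∀ w {R} → (∀ {x} → x < w → R x ≡ true) → count R w ≡ w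
count-true zero    _   = refl
count-true (suc w) {R} all with R 0 | all z<s
... | true | _ = cong suc (count-true w (all ∘ s≤s))

count-false : ∀ w {R} → (∀ {x} → x < w → R x ≡ false) → count R w ≡ 0
count-false zero    _    = refl
count-false (suc w) {R} none with R 0 | none z<s
... | false | _ = count-false w (none ∘ s≤s)

length-filter-tabulate : ∀ {A : Set} {P : A → Set} (P? : Decidable P) {N} (g : Fin N → A) R →
  (∀ i → does (P? (g i)) ≡ R (toℕ i)) → length (filter P? (tabulate g)) ≡ count R N
length-filter-tabulate P? {zero}  g R eq = refl
length-filter-tabulate P? {suc N} g R eq with does (P? (g Fin.zero)) | R 0 | eq Fin.zero
... | true  | true  | _ = cong suc (length-filter-tabulate P? (g ∘ Fin.suc) (R ∘ suc) (eq ∘ Fin.suc))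
... | false | false | _ = length-filter-tabulate P? (g ∘ Fin.suc) (R ∘ suc) (eq ∘ Fin.suc)

unique-window-length : ∀ {M} w a {ns : List (Fin M)} → Unique ns →
  All (λ u → a ≤ toℕ u × toℕ u < a + w) ns → length ns ≤ w
unique-window-length zero a {[]} _ _ = z≤n
unique-window-length zero a {u ∷ _} _ ((a≤u , u<a+0) ∷ _) =
  contradiction (<-≤-trans u<a+0 (≤-reflexive (+-identityʳ a))) (≤⇒≯ a≤u)
unique-window-length (suc w) a {ns} un inW =
  ≤-trans (removes-at-most-one un)
    (s≤s (unique-window-length w (suc a) (Unique.filter⁺ ≢a? un)
      (All.map shift (All.zip (All.all-filter ≢a? ns , All.filter⁺ ≢a? inW)))))
  where
  ≢a? = λ (u : Fin _) → ¬? (toℕ u ≟ a)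
  shift : ∀ {u} → toℕ u ≢ a × (a ≤ toℕ u × toℕ u < a + suc w) → suc a ≤ toℕ u × toℕ u < suc a + w
  shift {u} (u≢a , a≤u , u<) = ≤∧≢⇒< a≤u (u≢a ∘ ≡-sym) , subst (toℕ u <_) (+-suc a w) u<
  removes-at-most-one : ∀ {ns} → Unique ns → length ns ≤ suc (length (filter ≢a? ns))
  removes-at-most-one {[]} [] = z≤n
  removes-at-most-one {u ∷ ns} (u≢ ∷ un) with toℕ u ≟ a
  ... | no u≢a = subst (λ l → suc (length ns) ≤ suc l) (≡-sym (cong length (filter-accept ≢a? u≢a)))
                   (s≤s (removes-at-most-one un))
  ... | yes u≡a = s≤s (≤-reflexive (≡-sym (cong length (begin
    filter ≢a? (u ∷ ns)  ≡⟨ filter-reject ≢a? (λ u≢a → u≢a u≡a) ⟩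
    filter ≢a? ns        ≡⟨ filter-all ≢a? (All.map (λ u≢w w≡a → u≢w (same u≡a w≡a)) u≢) ⟩
    ns                   ∎))))
    where
    open ≡-Reasoning
    same : ∀ {u w} → toℕ u ≡ a → toℕ w ≡ a → u ≡ w
    same u≡a w≡a = toℕ-injective (trans u≡a (≡-sym w≡a))

-- Tree classes in an arbitrary graph

module _ {N : ℕ} (G : Graph N) {C : Fin N → Set} where

  TreeClass : ℕ → Set
  TreeClass k = ¬ InducedCycle G C × MaxDegInducedLe G C k

  independent⇒treeClass : ∀ {k} → (∀ {u w} → C u → C w → ¬ Adj G u w) → TreeClass k
  independent⇒treeClass indep = noCycle , noEdges
    where
    noCycle : ¬ InducedCycle G C
    noCycle record { rest = [] ; long = () }
    noCycle record { rest = _ ∷ _ ; inP = Cf ∷ Cv ∷ _ ; closed = f~v ∷ _ } = indep Cf Cv f~v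
    noEdges : MaxDegInducedLe G C _
    noEdges v Cv []                        _ _ = z≤n
    noEdges v Cv (u ∷ _) _ ((Cu , v~u) ∷ _) = contradiction v~u (indep Cv Cu)

  -- Every edge of a star contains c, but a cycle has at least three edges and only two of them contain c.
  star⇒noCycle : (c : ℕ) → (∀ {u w} → C u → C w → Adj G u w → toℕ u ≡ c ⊎ toℕ w ≡ c) →
    ¬ InducedCycle G C
  star⇒noCycle c hub record { rest = [] ; long = () }
  star⇒noCycle c hub record { rest = _ ∷ [] ; long = s≤s () }
  star⇒noCycle c hub record
    { first = f ; rest = v₁ ∷ v₂ ∷ r ; uniq = (f≢v₁ ∷ f≢v₂ ∷ _) ∷ (v₁≢v₂ ∷ v₁≢r) ∷ _
    ; inP = Cf ∷ Cv₁ ∷ Cv₂ ∷ Cr ; closed = f~v₁ ∷ v₁~v₂ ∷ v₂~ } =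
    cases (hub Cf Cv₁ f~v₁) (hub Cv₁ Cv₂ v₁~v₂)
    where
    same : ∀ {u w} → toℕ u ≡ c → toℕ w ≡ c → u ≡ w
    same u≡c w≡c = toℕ-injective (trans u≡c (≡-sym w≡c))
    next : ∀ r → All C r → All (v₁ ≢_) r → Linked (Adj G) (v₂ ∷ r ++ [ f ]) →
      ∃ λ w → C w × v₁ ≢ w × Adj G v₂ w
    next []      []       []         (v₂~f ∷ _) = f , Cf , f≢v₁ ∘ ≡-sym , v₂~f
    next (w ∷ _) (Cw ∷ _) (v₁≢w ∷ _) (v₂~w ∷ _) = w , Cw , v₁≢w , v₂~w
    cases : toℕ f ≡ c ⊎ toℕ v₁ ≡ c → toℕ v₁ ≡ c ⊎ toℕ v₂ ≡ c → ⊥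
    cases (inj₁ f≡c)  (inj₂ v₂≡c) = f≢v₂ (same f≡c v₂≡c)
    cases (inj₂ v₁≡c) (inj₂ v₂≡c) = v₁≢v₂ (same v₁≡c v₂≡c)
    cases _           (inj₁ v₁≡c) with w , Cw , v₁≢w , v₂~w ← next r Cr v₁≢r v₂~ =
      [ v₁≢v₂ ∘ same v₁≡c , v₁≢w ∘ same v₁≡c ]′ (hub Cv₂ Cw v₂~w)

  window⇒maxDeg : ∀ a k → (∀ {v} → C v → a ≤ toℕ v × toℕ v < a + suc k) → MaxDegInducedLe G C k
  window⇒maxDeg a k inW v Cv ns un nbrs =
    ≤-pred (unique-window-length (suc k) a (v∉ns ∷ un) (inW Cv ∷ All.map (inW ∘ proj₁) nbrs))
    where
    v∉ns : All (v ≢_) ns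
    v∉ns = All.map (λ (_ , v~u) v≡u → irrefl G (subst (Adj G v) (≡-sym v≡u) v~u)) nbrs

-- Blocks of consecutive vertices of K_{n,n,n}

module _ (n : ℕ) where

  part : Fin (3 * n) → ℕ
  part v = toℕ (quotient {3} n v)

  part-≡ : ∀ v p → n * p ≤ toℕ v → toℕ v < n * suc p → part v ≡ p
  part-≡ v p lo hi = ≤-antisym
    (≤-pred (*-cancelˡ-< n (part v) (suc p)
      (≤-<-trans (subst (n * part v ≤_) (≡-sym toℕ≡) (m≤m+n _ _)) hi)))
    (≤-pred (*-cancelˡ-< n p (suc (part v)) (≤-<-trans lo toℕ<)))
    where
    toℕ≡ : toℕ v ≡ n * part v + toℕ (remainder {3} n v)
    toℕ≡ = trans (cong toℕ (≡-sym (combine-remQuot {3} n v)))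
                 (toℕ-combine (quotient {3} n v) (remainder {3} n v))
    toℕ< : toℕ v < n * suc (part v)
    toℕ< = subst₂ _<_ (≡-sym toℕ≡) (trans (+-comm _ n) (≡-sym (*-suc n (part v))))
             (+-monoʳ-< (n * part v) (toℕ<n (remainder {3} n v)))

  samePart⇒¬Adj : ∀ {u w} → part u ≡ part w → ¬ Adj (Knnn n) u w
  samePart⇒¬Adj same u~w = u~w (toℕ-injective same)

-- The vertices numbered a, …, a + s − 1 of K_{n,n,n}: inside part p; or the last vertex of
-- part p followed by vertices of part p + 1; or vertices of part p followed by the first vertex
-- of part p + 1.
data GoodBlock (n a s : ℕ) : Set where
  inPart  : ∀ p → n * p ≤ a → a + s ≤ n * suc p → GoodBlock n a s
  lastOf  : ∀ p → s ≤ 4 → suc a ≡ n * suc p → a + s ≤ n * suc (suc p) → GoodBlock n a s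
  firstOf : ∀ p → s ≤ 4 → n * p ≤ a → a + s ≡ suc (n * suc p) → GoodBlock n a s

module _ {n : ℕ} {C : Fin (3 * n) → Set} where

  starOfPart⇒treeClass : ∀ c p {a s} → s ≤ 4 → (∀ {v} → C v → toℕ v ≡ c ⊎ part n v ≡ p) →
    (∀ {v} → C v → a ≤ toℕ v × toℕ v < a + s) → TreeClass (Knnn n) {C} 3
  starOfPart⇒treeClass c p {a} s≤4 centreOrPart inB =
    star⇒noCycle (Knnn n) c hub ,
    window⇒maxDeg (Knnn n) a 3 (λ Cv → proj₁ (inB Cv) , <-≤-trans (proj₂ (inB Cv)) (+-monoʳ-≤ a s≤4))
    where
    hub : ∀ {u w} → C u → C w → Adj (Knnn n) u w → toℕ u ≡ c ⊎ toℕ w ≡ c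
    hub Cu Cw u~w with centreOrPart Cu | centreOrPart Cw
    ... | inj₁ u≡c | _        = inj₁ u≡c
    ... | inj₂ _   | inj₁ w≡c = inj₂ w≡c
    ... | inj₂ u∈p | inj₂ w∈p = contradiction u~w (samePart⇒¬Adj n (trans u∈p (≡-sym w∈p)))

  goodBlock⇒treeClass : ∀ {a s} → GoodBlock n a s → (∀ {v} → C v → a ≤ toℕ v × toℕ v < a + s) →
    TreeClass (Knnn n) {C} 3
  goodBlock⇒treeClass (inPart p lo hi) inB = independent⇒treeClass (Knnn n) λ Cu Cw →
    samePart⇒¬Adj n (trans (inP Cu) (≡-sym (inP Cw)))
    where
    inP : ∀ {v} → C v → part n v ≡ p
    inP {v} Cv = part-≡ n v p (≤-trans lo (proj₁ (inB Cv))) (<-≤-trans (proj₂ (inB Cv)) hi)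
  goodBlock⇒treeClass {a} (lastOf p s≤4 last hi) inB =
    starOfPart⇒treeClass a (suc p) s≤4 centreOrPart inB
    where
    centreOrPart : ∀ {v} → C v → toℕ v ≡ a ⊎ part n v ≡ suc p
    centreOrPart {v} Cv with toℕ v ≟ a
    ... | yes v≡a = inj₁ v≡a
    ... | no  v≢a = inj₂ (part-≡ n v (suc p)
                            (subst (_≤ toℕ v) last (≤∧≢⇒< (proj₁ (inB Cv)) (v≢a ∘ ≡-sym)))
                            (<-≤-trans (proj₂ (inB Cv)) hi))
  goodBlock⇒treeClass (firstOf p s≤4 lo first) inB =
    starOfPart⇒treeClass (n * suc p) p s≤4 centreOrPart inB
    where
    centreOrPart : ∀ {v} → C v → toℕ v ≡ n * suc p ⊎ part n v ≡ p
    centreOrPart {v} Cv with toℕ v ≟ n * suc p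
    ... | yes v≡c = inj₁ v≡c
    ... | no  v≢c = inj₂ (part-≡ n v p (≤-trans lo (proj₁ (inB Cv)))
                            (≤∧≢⇒< (≤-pred (subst (toℕ v <_) first (proj₂ (inB Cv)))) v≢c))

boundaryOffset : ∀ {d s} → 0 < d → d < s → s ≤ 4 → d ≡ 1 ⊎ s ≡ suc d ⊎ (d ≡ 2 × s ≡ 4)
boundaryOffset {1}     _ _ _ = inj₁ refl
boundaryOffset {2} {3} _ _ _ = inj₂ (inj₁ refl)
boundaryOffset {2} {4} _ _ _ = inj₂ (inj₂ (refl , refl))
boundaryOffset {3} {4} _ _ _ = inj₂ (inj₁ refl)
boundaryOffset {2} {1} _ (s≤s ()) _
boundaryOffset {3} {1} _ (s≤s ()) _
boundaryOffset {2} {2} _ (s≤s (s≤s ())) _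
boundaryOffset {3} {2} _ (s≤s (s≤s ())) _
boundaryOffset {3} {3} _ (s≤s (s≤s (s≤s ()))) _
boundaryOffset {2} {suc (suc (suc (suc (suc _))))} _ _ (s≤s (s≤s (s≤s (s≤s ()))))
boundaryOffset {3} {suc (suc (suc (suc (suc _))))} _ _ (s≤s (s≤s (s≤s (s≤s ()))))
boundaryOffset {suc (suc (suc (suc _)))} _ d<s s≤4 with ≤-trans d<s s≤4
... | s≤s (s≤s (s≤s (s≤s ())))

-- A part boundary inside a block of at most four vertices cuts off a single vertex, unless it
-- cuts a block of four into 2 + 2.
goodBlock : ∀ {n a s} → 3 ≤ n → s ≤ 4 → (s ≡ 4 → n ∤ a + 2) → GoodBlock n a s
goodBlock {n@(suc _)} {a} {s} 3≤n s≤4 notHalved = inPartOf (a / n) lo a<B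
  where
  lo : n * (a / n) ≤ a
  lo = subst (_≤ a) (*-comm (a / n) n) (m/n*n≤m a n)
  a<B : a < n * suc (a / n)
  a<B = begin-strict
    a                   ≡⟨ m≡m%n+[m/n]*n a n ⟩
    a % n + a / n * n   <⟨ +-monoˡ-< (a / n * n) (m%n<n a n) ⟩
    n + a / n * n       ≡⟨ cong (n +_) (*-comm (a / n) n) ⟩
    n + n * (a / n)     ≡⟨ *-suc n (a / n) ⟨
    n * suc (a / n)     ∎
    where open ≤-Reasoning
  offset-pos : ∀ {p d} → a < n * suc p → a + d ≡ n * suc p → 0 < d
  offset-pos {d = zero}  a<B a+0≡B = contradiction (trans (≡-sym (+-identityʳ a)) a+0≡B) (<⇒≢ a<B)
  offset-pos {d = suc _} _   _     = z<s
  offset<s : ∀ {p d} → ¬ (a + s ≤ n * suc p) → a + d ≡ n * suc p → d < s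
  offset<s ¬fits a+d≡B = +-cancelˡ-< a _ s (subst (_< a + s) (≡-sym a+d≡B) (≰⇒> ¬fits))
  lastOf-fits : ∀ {p} → suc a ≡ n * suc p → a + s ≤ n * suc (suc p)
  lastOf-fits {p} last = begin
    a + s              ≤⟨ +-monoʳ-≤ a s≤4 ⟩
    a + 4              ≡⟨ +-suc a 3 ⟩
    suc a + 3          ≡⟨ cong (_+ 3) last ⟩
    n * suc p + 3      ≤⟨ +-monoʳ-≤ (n * suc p) 3≤n ⟩
    n * suc p + n      ≡⟨ +-comm (n * suc p) n ⟩
    n + n * suc p      ≡⟨ *-suc n (suc p) ⟨
    n * suc (suc p)    ∎
    where open ≤-Reasoning
  inPartOf : ∀ p → n * p ≤ a → a < n * suc p → GoodBlock n a s
  inPartOf p lo a<B with a + s ≤? n * suc p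
  ... | yes fits = inPart p lo fits
  ... | no ¬fits with d , a+d≡B ← m≤n⇒∃[o]m+o≡n (<⇒≤ a<B)
                 with boundaryOffset (offset-pos a<B a+d≡B) (offset<s ¬fits a+d≡B) s≤4
  ...   | inj₁ refl = lastOf p s≤4 (trans (+-comm 1 a) a+d≡B) (lastOf-fits (trans (+-comm 1 a) a+d≡B))
  ...   | inj₂ (inj₁ refl) = firstOf p s≤4 lo (trans (+-suc a d) (cong suc a+d≡B))
  ...   | inj₂ (inj₂ (refl , refl)) =
    contradiction (divides (suc p) (trans a+d≡B (*-comm n (suc p)))) (notHalved refl)

data GoodLayout (n : ℕ) : ℕ → List ℕ → Set where
  []  : ∀ {a} → GoodLayout n a []
  _∷_ : ∀ {a s S} → GoodBlock n a s → GoodLayout n (a + s) S → GoodLayout n a (s ∷ S)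

infixr 5 _++ᴸ_

_++ᴸ_ : ∀ {n a S T} → GoodLayout n a S → GoodLayout n (a + sum S) T → GoodLayout n a (S ++ T)
_++ᴸ_ {n} {a} {T = T} [] L = subst (λ b → GoodLayout n b T) (+-identityʳ a) L
_++ᴸ_ {n} {a} {T = T} (_∷_ {s = s} {S} B Bs) L =
  B ∷ (Bs ++ᴸ subst (λ b → GoodLayout n b T) (≡-sym (+-assoc a s (sum S))) L)

withinPart : ∀ {n a} p S → n * p ≤ a → a + sum S ≤ n * suc p → GoodLayout n a S
withinPart p []      _  _  = []
withinPart {n} {a} p (s ∷ S) lo hi =
  inPart p lo (≤-trans (+-monoʳ-≤ a (m≤m+n s (sum S))) hi) ∷
  withinPart p S (≤-trans lo (m≤m+n a s)) (subst (_≤ n * suc p) (≡-sym (+-assoc a s (sum S))) hi)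

smallBlocks : ∀ {n a S} → 3 ≤ n → All (_≤ 3) S → GoodLayout n a S
smallBlocks 3≤n []          = []
smallBlocks 3≤n (s≤3 ∷ S≤3) =
  goodBlock 3≤n (m≤n⇒m≤1+n s≤3) (λ s≡4 → contradiction s≡4 (<⇒≢ (s≤s s≤3))) ∷
  smallBlocks 3≤n S≤3

-- Part boundaries are even, so each one cuts a four starting at an odd position as 1 + 3 or 3 + 1.
foursFromOdd : ∀ {n a} f → 3 ≤ n → 2 ∣ n → 2 ∤ a → GoodLayout n a (replicate f 4)
foursFromOdd zero    3≤n 2∣n 2∤a = []
foursFromOdd {n} {a} (suc f) 3≤n 2∣n 2∤a =
  goodBlock 3≤n ≤-refl (λ _ n∣a+2 → 2∤a (2∣a+even 2 (∣-trans 2∣n n∣a+2) (divides 1 refl))) ∷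
  foursFromOdd f 3≤n 2∣n (λ 2∣a+4 → 2∤a (2∣a+even 4 2∣a+4 (divides 2 refl)))
  where
  2∣a+even : ∀ b → 2 ∣ a + b → 2 ∣ b → 2 ∣ a
  2∣a+even b 2∣a+b 2∣b = ∣m+n∣m⇒∣n (subst (2 ∣_) (+-comm a b) 2∣a+b) 2∣b

blockIndex : List ℕ → ℕ → ℕ
blockIndex []      x = 0
blockIndex (s ∷ S) x with x <? s
... | yes _ = 0
... | no  _ = suc (blockIndex S (x ∸ s))

blockSize : List ℕ → ℕ → ℕ
blockSize []      _       = 0
blockSize (s ∷ S) zero    = s
blockSize (s ∷ S) (suc j) = blockSize S j

blockIndex-head : ∀ {s} S {x} → x < s → blockIndex (s ∷ S) x ≡ 0
blockIndex-head {s} S {x} x<s with x <? s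
... | yes _   = refl
... | no  x≮s = contradiction x<s x≮s

blockIndex-tail : ∀ s S y → blockIndex (s ∷ S) (s + y) ≡ suc (blockIndex S y)
blockIndex-tail s S y with s + y <? s
... | yes s+y<s = contradiction (m≤m+n s y) (<⇒≱ s+y<s)
... | no  _     = cong (suc ∘ blockIndex S) (m+n∸m≡n s y)

headOrTail : ∀ s x → x < s ⊎ ∃ λ y → s + y ≡ x
headOrTail s x with x <? s
... | yes x<s = inj₁ x<s
... | no  x≮s = inj₂ (m≤n⇒∃[o]m+o≡n (≮⇒≥ x≮s))

blockIndex-< : ∀ S {x} → x < sum S → blockIndex S x < length S
blockIndex-< (s ∷ S) {x} x< with headOrTail s x
... | inj₁ x<s       rewrite blockIndex-head S x<s = z<s
... | inj₂ (y , refl) rewrite blockIndex-tail s S y = s≤s (blockIndex-< S (+-cancelˡ-< s y (sum S) x<))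

blockIndex-∈ : ∀ S {x} → x < sum S → let j = blockIndex S x in
  sum (take j S) ≤ x × x < sum (take j S) + blockSize S j
blockIndex-∈ (s ∷ S) {x} x< with headOrTail s x
... | inj₁ x<s       rewrite blockIndex-head S x<s = z≤n , x<s
... | inj₂ (y , refl) rewrite blockIndex-tail s S y
  with lo , hi ← blockIndex-∈ S (+-cancelˡ-< s y (sum S) x<) =
  +-monoʳ-≤ s lo , subst (s + y <_) (≡-sym (+-assoc s _ _)) (+-monoʳ-< s hi)

count-blockIndex : ∀ S j → count (λ x → does (blockIndex S x ≟ j)) (sum S) ≡ blockSize S j
count-blockIndex []      j = refl
count-blockIndex (s ∷ S) j = trans (count-+ _ s (sum S)) (cases j)
  where
  cases : ∀ j → count (λ x → does (blockIndex (s ∷ S) x ≟ j)) s +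
                count (λ y → does (blockIndex (s ∷ S) (s + y) ≟ j)) (sum S) ≡ blockSize (s ∷ S) j
  cases zero = trans (cong₂ _+_
    (count-true s λ x<s → cong (λ b → does (b ≟ 0)) (blockIndex-head S x<s))
    (count-false (sum S) λ {y} _ → cong (λ b → does (b ≟ 0)) (blockIndex-tail s S y)))
    (+-identityʳ s)
  cases (suc j) = cong₂ _+_
    (count-false s λ x<s → cong (λ b → does (b ≟ suc j)) (blockIndex-head S x<s))
    (trans (count-cong (sum S) λ {y} _ → cong (λ b → does (b ≟ suc j)) (blockIndex-tail s S y))
           (count-blockIndex S j))

goodLayout-block : ∀ {n a S j} → GoodLayout n a S → j < length S →
  GoodBlock n (a + sum (take j S)) (blockSize S j)
goodLayout-block {n} {a} {s ∷ _} {zero} (B ∷ _) _ = subst (λ b → GoodBlock n b s) (≡-sym (+-identityʳ a)) B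
goodLayout-block {n} {a} {s ∷ S} {suc j} (_ ∷ L) (s≤s j<) =
  subst (λ b → GoodBlock n b (blockSize S j)) (+-assoc a s (sum (take j S))) (goodLayout-block L j<)

blockSize-All : ∀ {P : ℕ → Set} {S j} → All P S → j < length S → P (blockSize S j)
blockSize-All {j = zero}  (p ∷ _)  _        = p
blockSize-All {j = suc j} (_ ∷ ps) (s≤s j<) = blockSize-All ps j<

-- Balanced tilings

record Tiling (m q c : ℕ) : Set where
  field
    sizes    : List ℕ
    length≡  : length sizes ≡ c
    sum≡     : sum sizes ≡ m
    balanced : All (λ s → s ≡ q ⊎ s ≡ suc q) sizes
open Tiling

sum-replicate : ∀ c s → sum (replicate c s) ≡ c * s
sum-replicate zero    s = refl
sum-replicate (suc c) s = cong (s +_) (sum-replicate c s)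

blocksOf : ∀ {q} c s → s ≡ q ⊎ s ≡ suc q → Tiling (c * s) q c
blocksOf c s s∈ = record
  { sizes = replicate c s ; length≡ = length-replicate c ; sum≡ = sum-replicate c s
  ; balanced = All.replicate⁺ c s∈ }

infixr 5 _++ᵀ_

_++ᵀ_ : ∀ {m m′ q c c′} → Tiling m q c → Tiling m′ q c′ → Tiling (m + m′) q (c + c′)
T ++ᵀ T′ = record
  { sizes    = sizes T ++ sizes T′
  ; length≡  = trans (length-++ (sizes T)) (cong₂ _+_ (length≡ T) (length≡ T′))
  ; sum≡     = trans (sum-++ (sizes T) (sizes T′)) (cong₂ _+_ (sum≡ T) (sum≡ T′))
  ; balanced = All.++⁺ (balanced T) (balanced T′) }

castᵀ : ∀ {m m′ q c c′} → m ≡ m′ → c ≡ c′ → Tiling m q c → Tiling m′ q c′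
castᵀ m≡ c≡ T = record
  { sizes = sizes T ; length≡ = trans (length≡ T) c≡ ; sum≡ = trans (sum≡ T) m≡ ; balanced = balanced T }

tiling : ∀ {m q c} → q * c ≤ m → m ≤ suc q * c → Tiling m q c
tiling {m} {q} {c} lo hi =
  castᵀ total (m+[n∸m]≡n r≤c) (blocksOf r (suc q) (inj₂ refl) ++ᵀ blocksOf (c ∸ r) q (inj₁ refl))
  where
  r = m ∸ q * c
  qc+r≡m : q * c + r ≡ m
  qc+r≡m = m+[n∸m]≡n lo
  r≤c : r ≤ c
  r≤c = +-cancelˡ-≤ (q * c) r c (subst₂ _≤_ (≡-sym qc+r≡m) (+-comm c (q * c)) hi)
  total : r * suc q + (c ∸ r) * q ≡ m
  total = begin
    r * suc q + (c ∸ r) * q  ≡⟨ regroup r (c ∸ r) q ⟩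
    q * (r + (c ∸ r)) + r    ≡⟨ cong (λ c → q * c + r) (m+[n∸m]≡n r≤c) ⟩
    q * c + r                ≡⟨ qc+r≡m ⟩
    m                        ∎
    where
    open ≡-Reasoning
    regroup : ∀ r e q → r * suc q + e * q ≡ q * (r + e) + r
    regroup = solve-∀

balanced⇒≤suc : ∀ {q a b} → a ≡ q ⊎ a ≡ suc q → b ≡ q ⊎ b ≡ suc q → a ≤ suc b
balanced⇒≤suc (inj₁ refl) (inj₁ refl) = n≤1+n _
balanced⇒≤suc (inj₁ refl) (inj₂ refl) = ≤-trans (n≤1+n _) (n≤1+n _)
balanced⇒≤suc (inj₂ refl) (inj₁ refl) = ≤-refl
balanced⇒≤suc (inj₂ refl) (inj₂ refl) = n≤1+n _

tilingColouring : ∀ {n q t} (T : Tiling (3 * n) q t) → GoodLayout n 0 (sizes T) →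
  HasEqTreeColoring (Knnn n) t 3
tilingColouring {n} T layout =
  subst (λ t → HasEqTreeColoring (Knnn n) t 3) (length≡ T) (colour , isTree , isEquitable)
  where
  S = sizes T
  inRange : (v : Fin (3 * n)) → toℕ v < sum S
  inRange v = subst (toℕ v <_) (≡-sym (sum≡ T)) (toℕ<n v)
  colour : Fin (3 * n) → Fin (length S)
  colour v = fromℕ< (blockIndex-< S (inRange v))
  colour≡ : ∀ {v i} → colour v ≡ i ⇔ blockIndex S (toℕ v) ≡ toℕ i
  colour≡ = mk⇔ (λ c≡i → trans (≡-sym (toℕ-fromℕ< _)) (cong toℕ c≡i))
                (λ b≡i → toℕ-injective (trans (toℕ-fromℕ< _) b≡i))
  classSize≡ : ∀ i → classSize (Knnn n) colour i ≡ blockSize S (toℕ i)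
  classSize≡ i = begin
    classSize (Knnn n) colour i  ≡⟨ length-filter-tabulate (λ v → colour v Fin.≟ i) id R
                                      (λ v → does-⇔ colour≡ (colour v Fin.≟ i) (blockIndex S (toℕ v) ≟ toℕ i)) ⟩
    count R (3 * n)              ≡⟨ cong (count R) (≡-sym (sum≡ T)) ⟩
    count R (sum S)              ≡⟨ count-blockIndex S (toℕ i) ⟩
    blockSize S (toℕ i)          ∎
    where
    open ≡-Reasoning
    R = λ x → does (blockIndex S x ≟ toℕ i)
  isTree : IsTreeColoring (Knnn n) (length S) 3 colour
  isTree i = goodBlock⇒treeClass (goodLayout-block layout (toℕ<n i)) λ {v} colour≡i →
    subst (λ j → sum (take j S) ≤ toℕ v × toℕ v < sum (take j S) + blockSize S j)
          (Equivalence.to colour≡ colour≡i) (blockIndex-∈ S (inRange v))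
  isEquitable : IsEquitable (Knnn n) (length S) colour
  isEquitable i j = subst₂ (λ a b → a ≤ suc b) (≡-sym (classSize≡ i)) (≡-sym (classSize≡ j))
    (balanced⇒≤suc (blockSize-All (balanced T) (toℕ<n i)) (blockSize-All (balanced T) (toℕ<n j)))

colours-partwise : ∀ {n q c₀ c₁ c₂} → Tiling n q c₀ → Tiling n q c₁ → Tiling n q c₂ →
  HasEqTreeColoring (Knnn n) (c₀ + c₁ + c₂) 3
colours-partwise {n} {c₀ = c₀} {c₁} {c₂} T₀ T₁ T₂ =
  tilingColouring (castᵀ (three n) (≡-sym (+-assoc c₀ c₁ c₂)) (T₀ ++ᵀ T₁ ++ᵀ T₂))
    (fillsPart 0 (≡-sym (*-zeroʳ n)) T₀ ++ᴸ fillsPart 1 start₁ T₁ ++ᴸ fillsPart 2 start₂ T₂)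
  where
  three : ∀ n → n + (n + n) ≡ 3 * n
  three = solve-∀
  fillsPart : ∀ {q c} p {a} → a ≡ n * p → (T : Tiling n q c) → GoodLayout n a (sizes T)
  fillsPart p {a} a≡ T = withinPart p (sizes T) (≤-reflexive (≡-sym a≡))
    (≤-reflexive (trans (cong₂ _+_ a≡ (sum≡ T)) (trans (+-comm (n * p) n) (≡-sym (*-suc n p)))))
  start₁ : sum (sizes T₀) ≡ n * 1
  start₁ = trans (sum≡ T₀) (≡-sym (*-identityʳ n))
  start₂ : sum (sizes T₀) + sum (sizes T₁) ≡ n * 2
  start₂ = trans (cong₂ _+_ (sum≡ T₀) (sum≡ T₁)) (twice n)
    where
    twice : ∀ n → n + n ≡ n * 2
    twice = solve-∀

colours-atMostThree : ∀ {n q t} → 3 ≤ n → q ≤ 2 → q * t ≤ 3 * n → 3 * n ≤ suc q * t →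
  HasEqTreeColoring (Knnn n) t 3
colours-atMostThree {q = q} 3≤n q≤2 lo hi =
  tilingColouring T (smallBlocks 3≤n (All.map ≤3 (balanced T)))
  where
  T = tiling lo hi
  ≤3 : ∀ {s} → s ≡ q ⊎ s ≡ suc q → s ≤ 3
  ≤3 (inj₁ refl) = m≤n⇒m≤1+n q≤2
  ≤3 (inj₂ refl) = s≤s q≤2

colours-many : ∀ {n t} → 3 ≤ n → n ≤ t → HasEqTreeColoring (Knnn n) t 3
colours-many {n} {t} 3≤n n≤t with 3 * n ≤? 1 * t | 3 * n ≤? 2 * t
... | yes 3n≤t  | _          = colours-atMostThree 3≤n z≤n z≤n 3n≤t
... | no  3n≰t  | yes 3n≤2t  = colours-atMostThree 3≤n (s≤s z≤n) (<⇒≤ (≰⇒> 3n≰t)) 3n≤2t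
... | no  _     | no  3n≰2t  = colours-atMostThree 3≤n ≤-refl (<⇒≤ (≰⇒> 3n≰2t)) (*-monoʳ-≤ 3 n≤t)

colours-threesFours : ∀ {n} d g → 3 ≤ n → 2 ∣ n → 1 + 4 * d + g ≡ n →
  HasEqTreeColoring (Knnn n) (1 + 3 * d + g) 3
colours-threesFours {n} d g 3≤n 2∣n n≡ = tilingColouring (castᵀ total refl T) layout
  where
  T = blocksOf 1 3 (inj₁ refl) ++ᵀ blocksOf (3 * d) 4 (inj₂ refl) ++ᵀ blocksOf g 3 (inj₁ refl)
  total : 1 * 3 + (3 * d * 4 + g * 3) ≡ 3 * n
  total = trans (regroup d g) (cong (3 *_) n≡)
    where
    regroup : ∀ d g → 1 * 3 + (3 * d * 4 + g * 3) ≡ 3 * (1 + 4 * d + g)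
    regroup = solve-∀
  layout : GoodLayout n 0 (3 ∷ replicate (3 * d) 4 ++ replicate g 3)
  layout = goodBlock 3≤n (n≤1+n 3) (λ ()) ∷
           (foursFromOdd (3 * d) 3≤n 2∣n (from-no (2 ∣? 3)) ++ᴸ
            smallBlocks 3≤n (All.replicate⁺ g ≤-refl))

colours-partwiseRange : ∀ {n q L U t} → (∀ {c} → L ≤ c → c ≤ U → Tiling n q c) →
  3 * L ≤ t → t ≤ 3 * U → HasEqTreeColoring (Knnn n) t 3
colours-partwiseRange {n} {L = L} {U} {t} tile 3L≤t t≤3U =
  subst (λ t → HasEqTreeColoring (Knnn n) t 3) (≡-sym t≡)
    (byRemainder (t / 3) (t % 3) (m%n<n t 3) (subst (3 * L ≤_) t≡ 3L≤t) (subst (_≤ 3 * U) t≡ t≤3U))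
  where
  t≡ : t ≡ 3 * (t / 3) + t % 3
  t≡ = trans (m≡m%n+[m/n]*n t 3) (trans (+-comm (t % 3) _) (cong (_+ t % 3) (*-comm (t / 3) 3)))
  lower : ∀ {m r} → r < 3 → 3 * L ≤ 3 * m + r → L ≤ m
  lower {m} {r} r<3 lo = ≤-pred (*-cancelˡ-< 3 L (suc m) (begin-strict
    3 * L      ≤⟨ lo ⟩
    3 * m + r  <⟨ +-monoʳ-< (3 * m) r<3 ⟩
    3 * m + 3  ≡⟨ +-comm (3 * m) 3 ⟩
    3 + 3 * m  ≡⟨ *-suc 3 m ⟨
    3 * suc m  ∎))
    where open ≤-Reasoning
  upper : ∀ {m r} → 3 * m + r ≤ 3 * U → m ≤ U
  upper {m} hi = *-cancelˡ-≤ 3 (≤-trans (m≤m+n (3 * m) _) hi)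
  upper⁺ : ∀ {m r} → 3 * m + suc r ≤ 3 * U → suc m ≤ U
  upper⁺ {m} {r} hi = *-cancelˡ-< 3 m U (<-≤-trans (m<m+n (3 * m) z<s) hi)
  sum₀ : ∀ m → m + m + m ≡ 3 * m + 0
  sum₀ = solve-∀
  sum₁ : ∀ m → m + m + suc m ≡ 3 * m + 1
  sum₁ = solve-∀
  sum₂ : ∀ m → m + suc m + suc m ≡ 3 * m + 2
  sum₂ = solve-∀
  byRemainder : ∀ m r → r < 3 → 3 * L ≤ 3 * m + r → 3 * m + r ≤ 3 * U →
    HasEqTreeColoring (Knnn n) (3 * m + r) 3
  byRemainder m 0 r<3 lo hi = subst (λ t → HasEqTreeColoring (Knnn n) t 3) (sum₀ m)
    (colours-partwise (tile l u) (tile l u) (tile l u))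
    where l = lower {m} r<3 lo; u = upper {m} hi
  byRemainder m 1 r<3 lo hi = subst (λ t → HasEqTreeColoring (Knnn n) t 3) (sum₁ m)
    (colours-partwise (tile l u) (tile l u) (tile (m≤n⇒m≤1+n l) (upper⁺ hi)))
    where l = lower {m} r<3 lo; u = upper {m} hi
  byRemainder m 2 r<3 lo hi = subst (λ t → HasEqTreeColoring (Knnn n) t 3) (sum₂ m)
    (colours-partwise (tile l u) (tile (m≤n⇒m≤1+n l) (upper⁺ hi)) (tile (m≤n⇒m≤1+n l) (upper⁺ hi)))
    where l = lower {m} r<3 lo; u = upper {m} hi
  byRemainder m (suc (suc (suc _))) (s≤s (s≤s (s≤s ()))) _ _

-- The case n = 4k + 2

3≤4k+2 : ∀ {k} → 1 ≤ k → 3 ≤ 4 * k + 2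
3≤4k+2 {k} 1≤k = ≤-trans (s≤s (s≤s (s≤s z≤n))) (+-monoˡ-≤ 2 (*-monoʳ-≤ 4 1≤k))

2∣4k+2 : ∀ k → 2 ∣ 4 * k + 2
2∣4k+2 k = divides (2 * k + 1) (double k)
  where
  double : ∀ k → 4 * k + 2 ≡ (2 * k + 1) * 2
  double = solve-∀

colours-3k+1 : ∀ {k} → 1 ≤ k → HasEqTreeColoring (Knnn (4 * k + 2)) (3 * k + 1) 3
colours-3k+1 {suc k} 1≤k = tilingColouring (castᵀ (total k) (blocks k) T) layout
  where
  n = 4 * suc k + 2
  T = blocksOf 1 5 (inj₂ refl) ++ᵀ blocksOf (2 * k + 2) 4 (inj₁ refl) ++ᵀ
      blocksOf 1 5 (inj₂ refl) ++ᵀ blocksOf k 4 (inj₁ refl)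
  total : ∀ k → 1 * 5 + ((2 * k + 2) * 4 + (1 * 5 + k * 4)) ≡ 3 * (4 * suc k + 2)
  total = solve-∀
  blocks : ∀ k → 1 + (2 * k + 2 + (1 + k)) ≡ 3 * suc k + 1
  blocks = solve-∀
  firstFive : ∀ k → 5 + (4 * k + 1) ≡ (4 * suc k + 2) * 1
  firstFive = solve-∀
  thirdPart : ∀ k → (4 * suc k + 2) * 2 + 1 ≡ 5 + (2 * k + 2) * 4
  thirdPart = solve-∀
  lastPart : ∀ k → 5 + (2 * k + 2) * 4 + (5 + k * 4) ≡ (4 * suc k + 2) * 3
  lastPart = solve-∀
  fours = sum-replicate (2 * k + 2) 4
  layout : GoodLayout n 0 (5 ∷ replicate (2 * k + 2) 4 ++ 5 ∷ replicate k 4)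
  layout =
    inPart 0 (≤-reflexive (*-zeroʳ n)) (m+o≡n⇒m≤n (4 * k + 1) (firstFive k)) ∷
    (foursFromOdd (2 * k + 2) (3≤4k+2 1≤k) (2∣4k+2 (suc k)) (from-no (2 ∣? 5)) ++ᴸ
     withinPart 2 (5 ∷ replicate k 4)
       (m+o≡n⇒m≤n 1 (trans (thirdPart k) (cong (5 +_) (≡-sym fours))))
       (≤-reflexive (trans (cong₂ (λ a b → 5 + a + (5 + b)) fours (sum-replicate k 4)) (lastPart k))))

colouring-4k+2 : ∀ {k} L t → 1 ≤ k → 4 * k + 2 ≤ 5 * L → 3 * L ≤ t →
  HasEqTreeColoring (Knnn (4 * k + 2)) t 3
colouring-4k+2 {k} L t 1≤k n≤5L 3L≤t with t ≤? 3 * k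
... | yes t≤3k = colours-partwiseRange fourOrFive 3L≤t t≤3k
  where
  fourOrFive : ∀ {c} → L ≤ c → c ≤ k → Tiling (4 * k + 2) 4 c
  fourOrFive {c} L≤c c≤k =
    tiling (≤-trans (*-monoʳ-≤ 4 c≤k) (m≤m+n (4 * k) 2)) (≤-trans n≤5L (*-monoʳ-≤ 5 L≤c))
... | no t≰3k with m≤n⇒m<n∨m≡n (≰⇒> t≰3k)
...   | inj₂ refl =
  subst (λ t → HasEqTreeColoring (Knnn (4 * k + 2)) t 3) (+-comm (3 * k) 1) (colours-3k+1 1≤k)
...   | inj₁ 3k+1<t with t ≤? 4 * k + 2
...     | no  t≰n = colours-many (3≤4k+2 1≤k) (<⇒≤ (≰⇒> t≰n))
...     | yes t≤n with x , refl ← m≤n⇒∃[o]m+o≡n 3k+1<t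
                  with y , t+y≡n ← m≤n⇒∃[o]m+o≡n t≤n =
  subst (λ t → HasEqTreeColoring (Knnn (4 * k + 2)) t 3) (colours≡ k x y x+y≡k)
    (colours-threesFours y (4 * x + 1) (3≤4k+2 1≤k) (2∣4k+2 k) (size≡ k x y x+y≡k))
  where
  x+y≡k : x + y ≡ k
  x+y≡k = +-cancelˡ-≡ (3 * k + 2) (x + y) k (trans (regroup k x y) (trans t+y≡n (split k)))
    where
    regroup : ∀ k x y → 3 * k + 2 + (x + y) ≡ suc (suc (3 * k)) + x + y
    regroup = solve-∀
    split : ∀ k → 4 * k + 2 ≡ 3 * k + 2 + k
    split = solve-∀
  size≡ : ∀ k x y → x + y ≡ k → 1 + 4 * y + (4 * x + 1) ≡ 4 * k + 2
  size≡ _ x y refl = size x y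
    where
    size : ∀ x y → 1 + 4 * y + (4 * x + 1) ≡ 4 * (x + y) + 2
    size = solve-∀
  colours≡ : ∀ k x y → x + y ≡ k → 1 + 3 * y + (4 * x + 1) ≡ suc (suc (3 * k)) + x
  colours≡ _ x y refl = colours x y
    where
    colours : ∀ x y → 1 + 3 * y + (4 * x + 1) ≡ suc (suc (3 * (x + y))) + x
    colours = solve-∀

strongBound-4k+2 : ∀ {k p} L → 1 ≤ k → 4 * k + 2 ≤ 5 * L → p ≡ 5 * (3 * L) →
  StrongEqVArbLe (Knnn (4 * k + 2)) 3 p 5
strongBound-4k+2 L 1≤k n≤5L refl t p≤5t = colouring-4k+2 L t 1≤k n≤5L (*-cancelˡ-≤ 5 p≤5t)

corollary3 : (k : ℕ) → 1 ≤ k →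
    ((k % 5 ≡ 3 → StrongEqVArbLe (Knnn (4 * k + 2)) 3 (12 * k + 9) 5)
    × (k % 5 ≡ 4 → StrongEqVArbLe (Knnn (4 * k + 2)) 3 (12 * k + 12) 5)
    × (k % 5 ≡ 0 → StrongEqVArbLe (Knnn (4 * k + 2)) 3 (12 * k + 15) 5)
    × (k % 5 ≡ 1 → StrongEqVArbLe (Knnn (4 * k + 2)) 3 (12 * k + 18) 5))
corollary3 k 1≤k =
  residue 3 1 solve-∀ solve-∀ , residue 4 2 solve-∀ solve-∀ ,
  residue 1 3 solve-∀ solve-∀ , residue 2 4 solve-∀ solve-∀
  where
  -- With k = c + 5m, ⌈(4k + 2) / 5⌉ = 4m + ℓ and the stated bound is p = 15 (4m + ℓ).
  m = k / 5
  residue : ∀ {c b} ℓ slack →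
    (∀ m → 4 * (c + m * 5) + 2 + slack ≡ 5 * (4 * m + ℓ)) →
    (∀ m → 12 * (c + m * 5) + b ≡ 5 * (3 * (4 * m + ℓ))) →
    k % 5 ≡ c → StrongEqVArbLe (Knnn (4 * k + 2)) 3 (12 * k + b) 5
  residue {c} {b} ℓ slack fits bound k%5≡c = strongBound-4k+2 (4 * m + ℓ) 1≤k
    (subst (λ k → 4 * k + 2 ≤ 5 * (4 * m + ℓ)) (≡-sym k≡) (m+o≡n⇒m≤n slack (fits m)))
    (trans (cong (λ k → 12 * k + b) k≡) (bound m))
    where
    k≡ : k ≡ c + m * 5
    k≡ = trans (m≡m%n+[m/n]*n k 5) (cong (_+ m * 5) k%5≡c)
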